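{- Let $A_1,\dots,A_n$ be closed formulas, let $\overline{x}$ be a tuple of variables, $\overline{\sigma}$ a corresponding tuple of fresh Skolem constants (not occurring in $A_1,\dots,A_n$ or $F$), and $F[\overline{x},y]$ a formula, and consider the specification $A_1\land\dots\land A_n\rightarrow\forall\overline{x}.\exists y.F[\overline{x},y]$. Let $\mathrm{ans}$ be a fresh unary predicate symbol not occurring in any of these formulas. Let $r[\overline{\sigma}]$ be a computable term and $C[\overline{\sigma}]$ a ground computable clause not containing an answer literal. Assume that the clause $C[\overline{\sigma}]\lor \mathrm{ans}(r[\overline{\sigma}])$ is derived from the set consisting of the initial clauses $A_1,\dots,A_n$, the clausified formula $\mathrm{cnf}(\lnot F[\overline{\sigma}, y]\lor\mathrm{ans}(y))$ and additional ground computable assumptions $C_1[\overline{\sigma}],\dots,C_m[\overline{\sigma}]$ (not containing $\mathrm{ans}$), by using saturation based on a sound inference system $\mathcal{I}$. Then \[\Big\langle r[\overline{x}],\ \bigwedge_{j=1}^{m}C_j[\overline{x}]\land\lnot C[\overline{x}]\Big\rangle\] is a program with conditions for the specification $A_1\land\dots\land A_n\rightarrow\forall\overline{x}.\exists y.F[\overline{x},y]$.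
   Context: A fixed set of signature symbols is designated computable; a term, literal or clause is computable if all symbols it contains are computable. Formulas/clauses with free variables are implicitly universally quantified; $\mathrm{cnf}(G)$ is the clausal normal form of $G$; an answer literal is a literal with predicate $\mathrm{ans}$. An inference system is sound if each conclusion is a logical consequence of its premises; a clause is derived by saturation based on $\mathcal{I}$ from a set $S$ if it is obtained from $S$ by finitely many applications of rules of $\mathcal{I}$. For a specification $\Phi := A_1\land\dots\land A_n\rightarrow\forall\overline{x}.\exists y.F[\overline{x},y]$ (equivalently $\forall\overline{x}.\exists y.(A_1\land\dots\land A_n\rightarrow F[\overline{x},y])$), a program with conditions $F_1,\dots,F_k$ for $\Phi$, written $\langle r[\overline{x}],\bigwedge_{i=1}^k F_i\rangle$, is a computable term $r[\overline{x}]$ together with computable formulas $F_1,\dots,F_k$ such that $\forall\overline{x}.\big(F_1\land\dots\land F_k\rightarrow (A_1\land\dots\land A_n\rightarrow F[\overline{x},r[\overline{x}]])\big)$ is valid. $C[\overline{x}]$ denotes $C[\overline{\sigma}]$ with $\overline{\sigma}$ replaced by $\overline{x}$. -}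

module Defs where

open import Level using (Level)
open import Data.Nat using (ℕ; _≡ᵇ_)
open import Data.Bool using (if_then_else_)
open import Data.Fin using (Fin; zero; suc)
open import Data.Maybe using (Maybe; just; nothing)
import Data.Maybe as Maybe
open import Data.List using (List; []; _∷_; _++_; foldr; map)
open import Data.List.Relation.Unary.All using (All)
open import Data.List.Relation.Unary.Any using (Any)
open import Data.Vec using (Vec; lookup)
import Data.Vec as Vec
open import Data.Product using (Σ; _×_)
open import Data.Sum using (_⊎_)
open import Data.Empty using (⊥)
open import Data.Unit using (⊤)
open import Relation.Nullary using (¬_)
open import Relation.Binary.PropositionalEquality using (_≡_)

data Term : Set where
  var : ℕ → Term
  fun : ℕ → List Term → Term

data Formula : Set where
  atom            : ℕ → List Term → Formula
  ⊤f ⊥f           : Formula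
  ¬f_             : Formula → Formula
  _∧f_ _∨f_ _⇒f_ _⇔f_ : Formula → Formula → Formula
  ∀f ∃f           : ℕ → Formula → Formula

data Literal : Set where
  pos neg : ℕ → List Term → Literal

-- A clause is a disjunction of literals (free variables implicitly
-- universally quantified).
Clause : Set
Clause = List Literal

litF : Literal → Formula
litF (pos p ts) = atom p ts
litF (neg p ts) = ¬f atom p ts

clF : Clause → Formula
clF = foldr (λ L φ → litF L ∨f φ) ⊥f

bigAnd : List Formula → Formula
bigAnd = foldr _∧f_ ⊤f

data FunInT (f : ℕ) : Term → Set where
  here  : ∀ {ts} → FunInT f (fun f ts)
  inArg : ∀ {g ts} → Any (FunInT f) ts → FunInT f (fun g ts)

data AppliedInT (f : ℕ) : Term → Set where
  here  : ∀ {t ts} → AppliedInT f (fun f (t ∷ ts))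
  inArg : ∀ {g ts} → Any (AppliedInT f) ts → AppliedInT f (fun g ts)

data VarInT (v : ℕ) : Term → Set where
  here  : VarInT v (var v)
  inArg : ∀ {g ts} → Any (VarInT v) ts → VarInT v (fun g ts)

data TermOccF (P : Term → Set) : Formula → Set where
  atm  : ∀ {p ts} → Any P ts → TermOccF P (atom p ts)
  neg  : ∀ {A} → TermOccF P A → TermOccF P (¬f A)
  ∧l   : ∀ {A B} → TermOccF P A → TermOccF P (A ∧f B)
  ∧r   : ∀ {A B} → TermOccF P B → TermOccF P (A ∧f B)
  ∨l   : ∀ {A B} → TermOccF P A → TermOccF P (A ∨f B)
  ∨r   : ∀ {A B} → TermOccF P B → TermOccF P (A ∨f B)
  ⇒l   : ∀ {A B} → TermOccF P A → TermOccF P (A ⇒f B)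
  ⇒r   : ∀ {A B} → TermOccF P B → TermOccF P (A ⇒f B)
  ⇔l   : ∀ {A B} → TermOccF P A → TermOccF P (A ⇔f B)
  ⇔r   : ∀ {A B} → TermOccF P B → TermOccF P (A ⇔f B)
  all  : ∀ {z A} → TermOccF P A → TermOccF P (∀f z A)
  ex   : ∀ {z A} → TermOccF P A → TermOccF P (∃f z A)

FunInF : ℕ → Formula → Set
FunInF f = TermOccF (FunInT f)

AppliedInF : ℕ → Formula → Set
AppliedInF f = TermOccF (AppliedInT f)

data PredInF (p : ℕ) : Formula → Set where
  atm  : ∀ {ts} → PredInF p (atom p ts)
  neg  : ∀ {A} → PredInF p A → PredInF p (¬f A)
  ∧l   : ∀ {A B} → PredInF p A → PredInF p (A ∧f B)
  ∧r   : ∀ {A B} → PredInF p B → PredInF p (A ∧f B)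
  ∨l   : ∀ {A B} → PredInF p A → PredInF p (A ∨f B)
  ∨r   : ∀ {A B} → PredInF p B → PredInF p (A ∨f B)
  ⇒l   : ∀ {A B} → PredInF p A → PredInF p (A ⇒f B)
  ⇒r   : ∀ {A B} → PredInF p B → PredInF p (A ⇒f B)
  ⇔l   : ∀ {A B} → PredInF p A → PredInF p (A ⇔f B)
  ⇔r   : ∀ {A B} → PredInF p B → PredInF p (A ⇔f B)
  all  : ∀ {z A} → PredInF p A → PredInF p (∀f z A)
  ex   : ∀ {z A} → PredInF p A → PredInF p (∃f z A)

data FreeIn (v : ℕ) : Formula → Set where
  atm  : ∀ {p ts} → Any (VarInT v) ts → FreeIn v (atom p ts)
  neg  : ∀ {A} → FreeIn v A → FreeIn v (¬f A)
  ∧l   : ∀ {A B} → FreeIn v A → FreeIn v (A ∧f B)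
  ∧r   : ∀ {A B} → FreeIn v B → FreeIn v (A ∧f B)
  ∨l   : ∀ {A B} → FreeIn v A → FreeIn v (A ∨f B)
  ∨r   : ∀ {A B} → FreeIn v B → FreeIn v (A ∨f B)
  ⇒l   : ∀ {A B} → FreeIn v A → FreeIn v (A ⇒f B)
  ⇒r   : ∀ {A B} → FreeIn v B → FreeIn v (A ⇒f B)
  ⇔l   : ∀ {A B} → FreeIn v A → FreeIn v (A ⇔f B)
  ⇔r   : ∀ {A B} → FreeIn v B → FreeIn v (A ⇔f B)
  all  : ∀ {z A} → ¬ v ≡ z → FreeIn v A → FreeIn v (∀f z A)
  ex   : ∀ {z A} → ¬ v ≡ z → FreeIn v A → FreeIn v (∃f z A)

FunInC : ℕ → Clause → Set
FunInC f C = FunInF f (clF C)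

PredInC : ℕ → Clause → Set
PredInC p C = PredInF p (clF C)

ComputableT : (ℕ → Set) → Term → Set
ComputableT CF t = ∀ f → FunInT f t → CF f

ComputableF : (ℕ → Set) → (ℕ → Set) → Formula → Set
ComputableF CF CP φ = (∀ f → FunInF f φ → CF f) × (∀ p → PredInF p φ → CP p)

ComputableC : (ℕ → Set) → (ℕ → Set) → Clause → Set
ComputableC CF CP C = ComputableF CF CP (clF C)

GroundC : Clause → Set
GroundC C = ∀ v → ¬ FreeIn v (clF C)

upd : ∀ {a} {A : Set a} → (ℕ → A) → ℕ → A → ℕ → A
upd ρ z d w = if w ≡ᵇ z then d else ρ w

mutual
  substT : (ℕ → Term) → Term → Term
  substT θ (var v)    = θ v
  substT θ (fun f ts) = fun f (substTs θ ts)

  substTs : (ℕ → Term) → List Term → List Term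
  substTs θ []       = []
  substTs θ (t ∷ ts) = substT θ t ∷ substTs θ ts

-- substitution for free variables; only used with closed terms in the
-- range (Skolem constants), hence no capture can occur
substF : (ℕ → Term) → Formula → Formula
substF θ (atom p ts) = atom p (substTs θ ts)
substF θ ⊤f          = ⊤f
substF θ ⊥f          = ⊥f
substF θ (¬f A)      = ¬f substF θ A
substF θ (A ∧f B)    = substF θ A ∧f substF θ B
substF θ (A ∨f B)    = substF θ A ∨f substF θ B
substF θ (A ⇒f B)    = substF θ A ⇒f substF θ B
substF θ (A ⇔f B)    = substF θ A ⇔f substF θ B
substF θ (∀f z A)    = ∀f z (substF (upd θ z (var z)) A)
substF θ (∃f z A)    = ∃f z (substF (upd θ z (var z)) A)

vindex : ∀ {k} → Vec ℕ k → ℕ → Maybe (Fin k)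
vindex Vec.[] n       = nothing
vindex (m Vec.∷ v) n  = if m ≡ᵇ n then just zero else Maybe.map suc (vindex v n)

instSk : ∀ {k} → Vec ℕ k → Vec ℕ k → ℕ → Term
instSk xs σs v with vindex xs v
... | just i  = fun (lookup σs i) []
... | nothing = var v

mutual
  unskT : ∀ {k} → Vec ℕ k → Vec ℕ k → Term → Term
  unskT xs σs (var v)          = var v
  unskT xs σs (fun f [])       with vindex σs f
  ... | just i  = var (lookup xs i)
  ... | nothing = fun f []
  unskT xs σs (fun f (t ∷ ts)) = fun f (unskTs xs σs (t ∷ ts))

  unskTs : ∀ {k} → Vec ℕ k → Vec ℕ k → List Term → List Term
  unskTs xs σs []       = []
  unskTs xs σs (t ∷ ts) = unskT xs σs t ∷ unskTs xs σs ts

unskL : ∀ {k} → Vec ℕ k → Vec ℕ k → Literal → Literal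
unskL xs σs (pos p ts) = pos p (unskTs xs σs ts)
unskL xs σs (neg p ts) = neg p (unskTs xs σs ts)

unskC : ∀ {k} → Vec ℕ k → Vec ℕ k → Clause → Clause
unskC xs σs = map (unskL xs σs)

-- Classical (Tarskian) semantics, rendered via the double-negation
-- translation so that it is classical although Agda is constructive.

record Structure : Set₁ where
  field
    Dom   : Set
    funI  : ℕ → List Dom → Dom
    predI : ℕ → List Dom → Set
open Structure public

Env : Structure → Set
Env M = ℕ → Dom M

mutual
  evalT : (M : Structure) → Env M → Term → Dom M
  evalT M ρ (var v)    = ρ v
  evalT M ρ (fun f ts) = funI M f (evalTs M ρ ts)

  evalTs : (M : Structure) → Env M → List Term → List (Dom M)
  evalTs M ρ []       = []
  evalTs M ρ (t ∷ ts) = evalT M ρ t ∷ evalTs M ρ ts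

⟦_⟧ : Formula → (M : Structure) → Env M → Set
⟦ atom p ts ⟧ M ρ = ¬ ¬ predI M p (evalTs M ρ ts)
⟦ ⊤f ⟧ M ρ        = ⊤
⟦ ⊥f ⟧ M ρ        = ⊥
⟦ ¬f A ⟧ M ρ      = ¬ ⟦ A ⟧ M ρ
⟦ A ∧f B ⟧ M ρ    = ⟦ A ⟧ M ρ × ⟦ B ⟧ M ρ
⟦ A ∨f B ⟧ M ρ    = ¬ ¬ (⟦ A ⟧ M ρ ⊎ ⟦ B ⟧ M ρ)
⟦ A ⇒f B ⟧ M ρ    = ⟦ A ⟧ M ρ → ⟦ B ⟧ M ρ
⟦ A ⇔f B ⟧ M ρ    = (⟦ A ⟧ M ρ → ⟦ B ⟧ M ρ) × (⟦ B ⟧ M ρ → ⟦ A ⟧ M ρ)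
⟦ ∀f z A ⟧ M ρ    = (d : Dom M) → ⟦ A ⟧ M (upd ρ z d)
⟦ ∃f z A ⟧ M ρ    = ¬ ¬ Σ (Dom M) (λ d → ⟦ A ⟧ M (upd ρ z d))

SatF : Structure → Formula → Set
SatF M φ = (ρ : Env M) → ⟦ φ ⟧ M ρ

Sat : Structure → Clause → Set
Sat M C = SatF M (clF C)

-- S is a clausal normal form of G: every model of
-- G can be expanded, by interpreting only the new (Skolem/naming)
-- symbols of S (those not occurring in G), to a model of S; and every
-- model of S is a model of G.

NewFun : Formula → List Clause → ℕ → Set
NewFun G S f = Any (FunInC f) S × ¬ FunInF f G

NewPred : Formula → List Clause → ℕ → Set
NewPred G S p = Any (PredInC p) S × ¬ PredInF p G

expand : (M : Structure) → (ℕ → List (Dom M) → Dom M) → (ℕ → List (Dom M) → Set) → Structure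
expand M fI pI = record { Dom = Dom M ; funI = fI ; predI = pI }

IsCNF : Formula → List Clause → Set₁
IsCNF G S =
  ((M : Structure) → SatF M G →
     ¬ ¬ Σ (ℕ → List (Dom M) → Dom M) λ fI →
         Σ (ℕ → List (Dom M) → Set) λ pI →
           (∀ f → ¬ NewFun G S f → ∀ ds → fI f ds ≡ funI M f ds) ×
           (∀ p → ¬ NewPred G S p → ∀ ds → pI p ds ≡ predI M p ds) ×
           All (Sat (expand M fI pI)) S)
  × ((M : Structure) → All (Sat M) S → SatF M G)

InferenceSystem : Set₁
InferenceSystem = List Clause → Clause → Set   -- premises ⊢ conclusion

Sound : InferenceSystem → Set₁
Sound I = ∀ {Ps C} → I Ps C → (M : Structure) → All (Sat M) Ps → Sat M C

data Derived (I : InferenceSystem) (S : List Clause) : Clause → Set where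
  axiom : ∀ {C} → Any (C ≡_) S → Derived I S C
  infer : ∀ {Ps C} → I Ps C → All (Derived I S) Ps → Derived I S C

-- F[x̄, r[x̄]] is rendered semantically: F evaluated with y
-- bound to the value of r (capture-avoiding substitution).
ProgramWithConditions : (CF CP : ℕ → Set) → List Clause → ℕ → Formula →
                        Term → Formula → Set₁
ProgramWithConditions CF CP As y F r cond =
  ComputableT CF r × ComputableF CF CP cond ×
  ((M : Structure) (ρ : Env M) → ⟦ cond ⟧ M ρ → All (Sat M) As →
     ⟦ F ⟧ M (upd ρ y (evalT M ρ r)))

goalFormula : ∀ {k} → Vec ℕ k → Vec ℕ k → ℕ → Formula → ℕ → Formula
goalFormula xs σs y F ans = (¬f substF (instSk xs σs) F) ∨f atom ans (var y ∷ [])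

conditions : ∀ {k} → Vec ℕ k → Vec ℕ k → List Clause → Clause → Formula
conditions xs σs Cjs C =
  bigAnd (map (λ Cj → clF (unskC xs σs Cj)) Cjs) ∧f (¬f clF (unskC xs σs C))

-- Let M ⊨ A₁,…,Aₙ and let ρ satisfy ⋀ Cⱼ[x̄] ∧ ¬C[x̄]. Reading each σᵢ as ρ(xᵢ) and ans(d) as
-- F[ρ(x̄), d] turns M into a model M′ of ¬F[σ̄,y] ∨ ans(y) and of A₁,…,Aₙ, Cⱼ[σ̄], while C[σ̄]
-- stays false. M′ expands to a model of the clausal normal form by reinterpreting only new symbols,
-- which are uncomputable and absent from the Aᵢ; so every premise of the derivation, hence by
-- soundness C[σ̄] ∨ ans(r[σ̄]), holds in it. The computable parts C[σ̄] and r[σ̄] are unaffected by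
-- the expansion, so ans(r[σ̄]) holds in M′, i.e. F[x̄, r[x̄]] holds in M under ρ. Everything is
-- classical because the semantics is the ¬¬-translation, whose formulas are stable.
{-# OPTIONS --safe #-}
module Submission where

open import Defs
open import Data.Nat using (ℕ; _≡ᵇ_; _≟_)
open import Data.Nat.Properties using (≡ᵇ⇒≡; ≡⇒≡ᵇ)
open import Data.Bool using (true; false; T)
open import Data.Fin using (Fin; zero; suc)
open import Data.Maybe using (just; nothing)
open import Data.List using (List; []; _∷_; _++_; map)
open import Data.List.Relation.Unary.All using (All; []; _∷_)
import Data.List.Relation.Unary.All as All
import Data.List.Relation.Unary.All.Properties as All
open import Data.List.Relation.Unary.Any using (Any; here; there)
import Data.List.Relation.Unary.Any.Properties as Any
open import Data.List.Relation.Binary.Permutation.Propositional using (_↭_)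
open import Data.List.Relation.Binary.Permutation.Propositional.Properties using (Any-resp-↭)
open import Data.Vec using (Vec; lookup)
import Data.Vec as Vec
open import Data.Product using (Σ; _×_; _,_; proj₁; proj₂)
open import Data.Product.Function.NonDependent.Propositional using (_×-⇔_)
open import Data.Product.Function.Dependent.Propositional using (Σ-⇔)
open import Data.Sum using (_⊎_; inj₁; inj₂; [_,_])
open import Data.Sum.Function.Propositional using (_⊎-⇔_)
open import Data.Empty using (⊥; ⊥-elim)
open import Data.Unit using (tt)
open import Function using (_∘_; id; _⇔_; mk⇔; Equivalence)
open import Function.Construct.Identity using (⇔-id; ↠-id)
open import Function.Related.TypeIsomorphisms using (→-cong-⇔; ¬-cong-⇔)
open import Relation.Nullary using (¬_; yes; no)
open import Relation.Nullary.Negation using (Stable; negated-stable; ¬¬-map)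
open import Relation.Binary.PropositionalEquality
  using (_≡_; _≢_; refl; sym; trans; cong; cong₂; cong-app; subst; module ≡-Reasoning)

open Equivalence using (to; from)

upd-same : ∀ {a} {A : Set a} (ρ : ℕ → A) z d → upd ρ z d z ≡ d
upd-same ρ z d with z ≡ᵇ z | ≡⇒≡ᵇ z z refl
... | true  | _ = refl
... | false | ()

upd-other : ∀ {a} {A : Set a} (ρ : ℕ → A) {z} d {w} → w ≢ z → upd ρ z d w ≡ ρ w
upd-other ρ {z} d {w} w≢z with w ≡ᵇ z | ≡ᵇ⇒≡ w z
... | false | _      = refl
... | true  | w≡ᵇz⇒ = ⊥-elim (w≢z (w≡ᵇz⇒ tt))

vindex-just : ∀ {k} (xs : Vec ℕ k) {n i} → vindex xs n ≡ just i → lookup xs i ≡ n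
vindex-just (m Vec.∷ xs) {n} eq with m ≡ᵇ n in m≡ᵇn
vindex-just (m Vec.∷ xs) {n} refl | true = ≡ᵇ⇒≡ m n (subst T (sym m≡ᵇn) tt)
vindex-just (m Vec.∷ xs) {n} eq   | false with vindex xs n in eq′
vindex-just (m Vec.∷ xs) refl     | false | just j = vindex-just xs eq′

vindex-nothing : ∀ {k} (xs : Vec ℕ k) {n} → vindex xs n ≡ nothing → ∀ i → lookup xs i ≢ n
vindex-nothing (m Vec.∷ xs) {n} eq i m≡n with m ≡ᵇ n in m≡ᵇn
vindex-nothing (m Vec.∷ xs) {n} eq zero m≡n    | false = subst T m≡ᵇn (≡⇒≡ᵇ m n m≡n)
vindex-nothing (m Vec.∷ xs) {n} eq (suc i) m≡n | false with vindex xs n in eq′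
vindex-nothing (m Vec.∷ xs) {n} eq (suc i) m≡n | false | nothing = vindex-nothing xs eq′ i m≡n

vindex-lookup : ∀ {k} (xs : Vec ℕ k) → (∀ i j → lookup xs i ≡ lookup xs j → i ≡ j) →
                ∀ i → vindex xs (lookup xs i) ≡ just i
vindex-lookup xs xs-inj i with vindex xs (lookup xs i) in eq
... | just j  = cong just (xs-inj j i (vindex-just xs eq))
... | nothing = ⊥-elim (vindex-nothing xs eq i refl)

instSk-vars : ∀ {k} (xs σs : Vec ℕ k) {v w} → VarInT w (instSk xs σs v) → w ≡ v
instSk-vars xs σs {v} w∈ with vindex xs v
instSk-vars xs σs (inArg ()) | just i
instSk-vars xs σs here       | nothing = refl

module _ {k : ℕ} (xs σs : Vec ℕ k) where

  mutual
    FunInT-unskT : ∀ {f} t → FunInT f (unskT xs σs t) → FunInT f t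
    FunInT-unskT (fun g []) o with vindex σs g
    FunInT-unskT (fun g []) () | just i
    FunInT-unskT (fun g []) o  | nothing = o
    FunInT-unskT (fun g (t ∷ ts)) here      = here
    FunInT-unskT (fun g (t ∷ ts)) (inArg o) = inArg (FunInTs-unskTs (t ∷ ts) o)

    FunInTs-unskTs : ∀ {f} ts → Any (FunInT f) (unskTs xs σs ts) → Any (FunInT f) ts
    FunInTs-unskTs (t ∷ ts) (here o)  = here (FunInT-unskT t o)
    FunInTs-unskTs (t ∷ ts) (there o) = there (FunInTs-unskTs ts o)

  FunInC-unskC : ∀ {f} L → FunInC f (unskC xs σs L) → FunInC f L
  FunInC-unskC (pos p ts ∷ L) (∨l (atm o))       = ∨l (atm (FunInTs-unskTs ts o))
  FunInC-unskC (neg p ts ∷ L) (∨l (neg (atm o))) = ∨l (neg (atm (FunInTs-unskTs ts o)))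
  FunInC-unskC (l ∷ L)        (∨r o)             = ∨r (FunInC-unskC L o)

  PredInC-unskC : ∀ {p} L → PredInC p (unskC xs σs L) → PredInC p L
  PredInC-unskC (pos q ts ∷ L) (∨l atm)       = ∨l atm
  PredInC-unskC (neg q ts ∷ L) (∨l (neg atm)) = ∨l (neg atm)
  PredInC-unskC (l ∷ L)        (∨r o)         = ∨r (PredInC-unskC L o)

unskT-computable : ∀ {CF k} (xs σs : Vec ℕ k) t → ComputableT CF t → ComputableT CF (unskT xs σs t)
unskT-computable xs σs t t-comp f o = t-comp f (FunInT-unskT xs σs t o)

module _ {CF CP : ℕ → Set} where

  unskC-computable : ∀ {k} (xs σs : Vec ℕ k) L → ComputableC CF CP L → ComputableC CF CP (unskC xs σs L)
  unskC-computable xs σs L (funs , preds) =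
    (λ f o → funs f (FunInC-unskC xs σs L o)) , (λ p o → preds p (PredInC-unskC xs σs L o))

  ¬f-computable : ∀ {A} → ComputableF CF CP A → ComputableF CF CP (¬f A)
  ¬f-computable (funs , preds) = (λ { f (neg o) → funs f o }) , (λ { p (neg o) → preds p o })

  ∧f-computable : ∀ {A B} → ComputableF CF CP A → ComputableF CF CP B → ComputableF CF CP (A ∧f B)
  ∧f-computable (funsA , predsA) (funsB , predsB) =
    (λ { f (∧l o) → funsA f o ; f (∧r o) → funsB f o }) ,
    (λ { p (∧l o) → predsA p o ; p (∧r o) → predsB p o })

  bigAnd-computable : ∀ {φs} → All (ComputableF CF CP) φs → ComputableF CF CP (bigAnd φs)
  bigAnd-computable []       = (λ _ ()) , (λ _ ())
  bigAnd-computable (φ ∷ φs) = ∧f-computable φ (bigAnd-computable φs)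

  conditions-computable : ∀ {k} (xs σs : Vec ℕ k) Cjs C →
    All (ComputableC CF CP) Cjs → ComputableC CF CP C → ComputableF CF CP (conditions xs σs Cjs C)
  conditions-computable xs σs Cjs C Cjs-comp C-comp =
    ∧f-computable (bigAnd-computable (All.map⁺ (All.map (λ {Cj} → unskC-computable xs σs Cj) Cjs-comp)))
                  (¬f-computable (unskC-computable xs σs C C-comp))

¬¬-cong-≡ : {P Q : Set} → P ≡ Q → (¬ ¬ P) ⇔ (¬ ¬ Q)
¬¬-cong-≡ refl = ⇔-id _

Π-⇔ : {A : Set} {B C : A → Set} → (∀ a → B a ⇔ C a) → ((a : A) → B a) ⇔ ((a : A) → C a)
Π-⇔ B⇔C = mk⇔ (λ f a → to (B⇔C a) (f a)) (λ g a → from (B⇔C a) (g a))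

⟦⟧-stable : ∀ A M ρ → Stable (⟦ A ⟧ M ρ)
⟦⟧-stable (atom p ts) M ρ = negated-stable
⟦⟧-stable ⊤f        M ρ _ = tt
⟦⟧-stable ⊥f        M ρ h = h id
⟦⟧-stable (¬f A)    M ρ = negated-stable
⟦⟧-stable (A ∧f B)  M ρ h = ⟦⟧-stable A M ρ (¬¬-map proj₁ h) , ⟦⟧-stable B M ρ (¬¬-map proj₂ h)
⟦⟧-stable (A ∨f B)  M ρ = negated-stable
⟦⟧-stable (A ⇒f B)  M ρ h a = ⟦⟧-stable B M ρ (¬¬-map (λ f → f a) h)
⟦⟧-stable (A ⇔f B)  M ρ h =
  (λ a → ⟦⟧-stable B M ρ (¬¬-map (λ e → proj₁ e a) h)) , (λ b → ⟦⟧-stable A M ρ (¬¬-map (λ e → proj₂ e b) h))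
⟦⟧-stable (∀f z A)  M ρ h d = ⟦⟧-stable A M (upd ρ z d) (¬¬-map (λ f → f d) h)
⟦⟧-stable (∃f z A)  M ρ = negated-stable

⟦clF⟧⇔¬¬Any : ∀ M ρ L → ⟦ clF L ⟧ M ρ ⇔ (¬ ¬ Any (λ l → ⟦ litF l ⟧ M ρ) L)
⟦clF⟧⇔¬¬Any M ρ []      = mk⇔ (λ ()) (λ h → h (λ ()))
⟦clF⟧⇔¬¬Any M ρ (l ∷ L) = mk⇔
  (λ h k → h [ k ∘ here , (λ L-true → to IH L-true (k ∘ there)) ])
  (λ h k → h λ { (here l-true) → k (inj₁ l-true) ; (there L-true) → k (inj₂ (from IH (λ k′ → k′ L-true))) })
  where IH = ⟦clF⟧⇔¬¬Any M ρ L

⟦bigAnd⟧ : ∀ {M ρ} φs → ⟦ bigAnd φs ⟧ M ρ → All (λ φ → ⟦ φ ⟧ M ρ) φs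
⟦bigAnd⟧ []       _                   = []
⟦bigAnd⟧ (φ ∷ φs) (φ-true , φs-true) = φ-true ∷ ⟦bigAnd⟧ φs φs-true

mutual
  evalT-substT : ∀ M ρ θ t → evalT M ρ (substT θ t) ≡ evalT M (evalT M ρ ∘ θ) t
  evalT-substT M ρ θ (var v)    = refl
  evalT-substT M ρ θ (fun f ts) = cong (funI M f) (evalTs-substTs M ρ θ ts)

  evalTs-substTs : ∀ M ρ θ ts → evalTs M ρ (substTs θ ts) ≡ evalTs M (evalT M ρ ∘ θ) ts
  evalTs-substTs M ρ θ []       = refl
  evalTs-substTs M ρ θ (t ∷ ts) = cong₂ _∷_ (evalT-substT M ρ θ t) (evalTs-substTs M ρ θ ts)

mutual
  substT-var : ∀ t → substT var t ≡ t
  substT-var (var v)    = refl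
  substT-var (fun f ts) = cong (fun f) (substTs-var ts)

  substTs-var : ∀ ts → substTs var ts ≡ ts
  substTs-var []       = refl
  substTs-var (t ∷ ts) = cong₂ _∷_ (substT-var t) (substTs-var ts)

substF-var-clF : ∀ L → substF var (clF L) ≡ clF L
substF-var-clF []             = refl
substF-var-clF (pos p ts ∷ L) = cong₂ (λ us φ → atom p us ∨f φ) (substTs-var ts) (substF-var-clF L)
substF-var-clF (neg p ts ∷ L) = cong₂ (λ us φ → (¬f atom p us) ∨f φ) (substTs-var ts) (substF-var-clF L)

module _ {I : InferenceSystem} (sound : Sound I) (M : Structure) {S : List Clause} (M⊨S : All (Sat M) S) where

  mutual
    Derived⇒Sat : ∀ {D} → Derived I S D → Sat M D
    Derived⇒Sat (axiom D∈S)        = All.lookup M⊨S D∈S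
    Derived⇒Sat (infer i premises) = sound i M (All-Derived⇒Sat premises)

    All-Derived⇒Sat : ∀ {Ps} → All (Derived I S) Ps → All (Sat M) Ps
    All-Derived⇒Sat []       = []
    All-Derived⇒Sat (d ∷ ds) = Derived⇒Sat d ∷ All-Derived⇒Sat ds

module _ (M : Structure) (fJ : ℕ → List (Dom M) → Dom M) (pJ : ℕ → List (Dom M) → Set) where

  private
    N : Structure
    N = expand M fJ pJ

  mutual
    evalT-coincidence : ∀ {ρ₁ ρ₂} t → (∀ {f} → FunInT f t → ∀ ds → funI M f ds ≡ fJ f ds) →
                        (∀ {v} → VarInT v t → ρ₁ v ≡ ρ₂ v) → evalT M ρ₁ t ≡ evalT N ρ₂ t
    evalT-coincidence (var v)    funs vals = vals here
    evalT-coincidence (fun f ts) funs vals =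
      trans (cong (funI M f) (evalTs-coincidence ts (funs ∘ inArg) (vals ∘ inArg))) (funs here _)

    evalTs-coincidence : ∀ {ρ₁ ρ₂} ts → (∀ {f} → Any (FunInT f) ts → ∀ ds → funI M f ds ≡ fJ f ds) →
                         (∀ {v} → Any (VarInT v) ts → ρ₁ v ≡ ρ₂ v) → evalTs M ρ₁ ts ≡ evalTs N ρ₂ ts
    evalTs-coincidence []       funs vals = refl
    evalTs-coincidence (t ∷ ts) funs vals =
      cong₂ _∷_ (evalT-coincidence t (funs ∘ here) (vals ∘ here))
                (evalTs-coincidence ts (funs ∘ there) (vals ∘ there))

module _ (M : Structure) (fJ : ℕ → List (Dom M) → Dom M) (pJ : ℕ → List (Dom M) → Set) where

  private
    N : Structure
    N = expand M fJ pJ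

  record Agree (θ : ℕ → Term) (ρ₁ ρ₂ : Env M) (A : Formula) : Set₁ where
    field
      funs       : ∀ {f} → FunInF f A → ∀ ds → funI M f ds ≡ fJ f ds
      preds      : ∀ {p} → PredInF p A → ∀ ds → predI M p ds ≡ pJ p ds
      values     : ∀ {v} → FreeIn v A → evalT M ρ₁ (θ v) ≡ ρ₂ v
      no-capture : ∀ {v} → FreeIn v A → ∀ {w} → VarInT w (θ v) → w ≡ v

  Agree-subformula : ∀ {θ ρ₁ ρ₂ A B} →
                     (∀ {f} → FunInF f B → FunInF f A) → (∀ {p} → PredInF p B → PredInF p A) →
                     (∀ {v} → FreeIn v B → FreeIn v A) → Agree θ ρ₁ ρ₂ A → Agree θ ρ₁ ρ₂ B
  Agree-subformula inF inP inV h = record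
    { funs = funs ∘ inF ; preds = preds ∘ inP ; values = values ∘ inV ; no-capture = no-capture ∘ inV }
    where open Agree h

  Agree-binder : ∀ {θ ρ₁ ρ₂ z A B} d →
                 (∀ {f} → FunInF f A → FunInF f B) → (∀ {p} → PredInF p A → PredInF p B) →
                 (∀ {v} → v ≢ z → FreeIn v A → FreeIn v B) →
                 Agree θ ρ₁ ρ₂ B → Agree (upd θ z (var z)) (upd ρ₁ z d) (upd ρ₂ z d) A
  Agree-binder {θ} {ρ₁} {ρ₂} {z} d inF inP inV h = record
    { funs = funs ∘ inF ; preds = preds ∘ inP ; values = values′ ; no-capture = no-capture′ }
    where
    open Agree h

    values′ : ∀ {v} → FreeIn v _ → evalT M (upd ρ₁ z d) (upd θ z (var z) v) ≡ upd ρ₂ z d v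
    values′ {v} v∈A with v ≟ z
    ... | yes refl rewrite upd-same θ z (var z) = trans (upd-same ρ₁ z d) (sym (upd-same ρ₂ z d))
    ... | no v≢z rewrite upd-other θ (var z) v≢z = begin
      evalT M (upd ρ₁ z d) (θ v)  ≡⟨ evalT-coincidence M (funI M) (predI M) (θ v) (λ _ _ → refl) z∉θv ⟩
      evalT M ρ₁ (θ v)            ≡⟨ values (inV v≢z v∈A) ⟩
      ρ₂ v                        ≡⟨ sym (upd-other ρ₂ d v≢z) ⟩
      upd ρ₂ z d v                ∎
      where
      open ≡-Reasoning
      z∉θv : ∀ {w} → VarInT w (θ v) → upd ρ₁ z d w ≡ ρ₁ w
      z∉θv w∈θv = upd-other ρ₁ d (λ w≡z → v≢z (trans (sym (no-capture (inV v≢z v∈A) w∈θv)) w≡z))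

    no-capture′ : ∀ {v} → FreeIn v _ → ∀ {w} → VarInT w (upd θ z (var z) v) → w ≡ v
    no-capture′ {v} v∈A {w} w∈ with v ≟ z
    ... | yes refl with subst (VarInT w) (upd-same θ z (var z)) w∈
    ...   | here = refl
    no-capture′ {v} v∈A {w} w∈ | no v≢z =
      no-capture (inV v≢z v∈A) (subst (VarInT w) (upd-other θ (var z) v≢z) w∈)

  ⟦substF⟧ : ∀ θ A {ρ₁ ρ₂} → Agree θ ρ₁ ρ₂ A → ⟦ substF θ A ⟧ M ρ₁ ⇔ ⟦ A ⟧ N ρ₂
  ⟦substF⟧ θ (atom p ts) {ρ₁} h = ¬¬-cong-≡ (trans (cong (predI M p) args) (preds atm _))
    where
    open Agree h
    args : evalTs M ρ₁ (substTs θ ts) ≡ evalTs N _ ts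
    args = trans (evalTs-substTs M ρ₁ θ ts) (evalTs-coincidence M fJ pJ ts (funs ∘ atm) (values ∘ atm))
  ⟦substF⟧ θ ⊤f       h = ⇔-id _
  ⟦substF⟧ θ ⊥f       h = ⇔-id _
  ⟦substF⟧ θ (¬f A)   h = ¬-cong-⇔ (⟦substF⟧ θ A (Agree-subformula neg neg neg h))
  ⟦substF⟧ θ (A ∧f B) h =
    ⟦substF⟧ θ A (Agree-subformula ∧l ∧l ∧l h) ×-⇔ ⟦substF⟧ θ B (Agree-subformula ∧r ∧r ∧r h)
  ⟦substF⟧ θ (A ∨f B) h = ¬-cong-⇔ (¬-cong-⇔
    (⟦substF⟧ θ A (Agree-subformula ∨l ∨l ∨l h) ⊎-⇔ ⟦substF⟧ θ B (Agree-subformula ∨r ∨r ∨r h)))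
  ⟦substF⟧ θ (A ⇒f B) h =
    →-cong-⇔ (⟦substF⟧ θ A (Agree-subformula ⇒l ⇒l ⇒l h)) (⟦substF⟧ θ B (Agree-subformula ⇒r ⇒r ⇒r h))
  ⟦substF⟧ θ (A ⇔f B) h = →-cong-⇔ ⟦A⟧ ⟦B⟧ ×-⇔ →-cong-⇔ ⟦B⟧ ⟦A⟧
    where
    ⟦A⟧ = ⟦substF⟧ θ A (Agree-subformula ⇔l ⇔l ⇔l h)
    ⟦B⟧ = ⟦substF⟧ θ B (Agree-subformula ⇔r ⇔r ⇔r h)
  ⟦substF⟧ θ (∀f z A) h = Π-⇔ λ d → ⟦substF⟧ (upd θ z (var z)) A (Agree-binder d all all all h)
  ⟦substF⟧ θ (∃f z A) h = ¬-cong-⇔ (¬-cong-⇔ (Σ-⇔ (↠-id _) λ {d} →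
    ⟦substF⟧ (upd θ z (var z)) A (Agree-binder d ex ex ex h)))

  ⟦clF⟧-coincidence : ∀ L {ρ₁ ρ₂} →
                      (∀ {f} → FunInC f L → ∀ ds → funI M f ds ≡ fJ f ds) →
                      (∀ {p} → PredInC p L → ∀ ds → predI M p ds ≡ pJ p ds) →
                      (∀ {v} → FreeIn v (clF L) → ρ₁ v ≡ ρ₂ v) → ⟦ clF L ⟧ M ρ₁ ⇔ ⟦ clF L ⟧ N ρ₂
  ⟦clF⟧-coincidence L {ρ₁} {ρ₂} funs preds vals =
    subst (λ φ → ⟦ φ ⟧ M ρ₁ ⇔ ⟦ clF L ⟧ N ρ₂) (substF-var-clF L) (⟦substF⟧ var (clF L) agree)
    where
    agree : Agree var ρ₁ ρ₂ (clF L)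
    agree = record { funs = funs ; preds = preds ; values = vals ; no-capture = λ { _ here → refl } }

ground-sat : ∀ M {ρ} L → GroundC L → ⟦ clF L ⟧ M ρ → Sat M L
ground-sat M L ground L-true ρ′ =
  to (⟦clF⟧-coincidence M (funI M) (predI M) L (λ _ _ → refl) (λ _ _ → refl) (⊥-elim ∘ ground _)) L-true

-- Answer literals

answer-sound :
  ∀ (CF CP : ℕ → Set) {I G S As Cjs C D ans r} →
  Sound I → IsCNF G S → PredInF ans G →
  (∀ f → NewFun G S f → ¬ CF f × All (λ A → ¬ FunInC f A) As) →
  (∀ p → NewPred G S p → ¬ CP p × All (λ A → ¬ PredInC p A) As) →
  ComputableT CF r → ComputableC CF CP C → All (ComputableC CF CP) Cjs →
  Derived I (As ++ S ++ Cjs) D → D ↭ C ++ pos ans (r ∷ []) ∷ [] →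
  ∀ M ρ → SatF M G → All (Sat M) As → All (Sat M) Cjs → ¬ ⟦ clF C ⟧ M ρ →
  ⟦ atom ans (r ∷ []) ⟧ M ρ
answer-sound CF CP {G = G} {S} {As} {Cjs} {C} {D} {ans} {r} sound cnf ans∈G new-fun new-pred
             r-comp C-comp Cjs-comp D-derived D↭ M ρ M⊨G M⊨As M⊨Cjs C-false =
  ⟦⟧-stable (atom ans (r ∷ [])) M ρ λ ¬answer →
    proj₁ cnf M M⊨G λ (fI , pI , old-fun , old-pred , M′⊨S) → ¬answer (answer fI pI old-fun old-pred M′⊨S)
  where
  module _ (fI : ℕ → List (Dom M) → Dom M) (pI : ℕ → List (Dom M) → Set)
           (old-fun : ∀ f → ¬ NewFun G S f → ∀ ds → fI f ds ≡ funI M f ds)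
           (old-pred : ∀ p → ¬ NewPred G S p → ∀ ds → pI p ds ≡ predI M p ds)
           (M′⊨S : All (Sat (expand M fI pI)) S) where

    M′ : Structure
    M′ = expand M fI pI

    computable-fun : ∀ {f} → CF f → ∀ ds → funI M f ds ≡ fI f ds
    computable-fun cf ds = sym (old-fun _ (λ new → proj₁ (new-fun _ new) cf) ds)

    computable-pred : ∀ {p} → CP p → ∀ ds → predI M p ds ≡ pI p ds
    computable-pred cp ds = sym (old-pred _ (λ new → proj₁ (new-pred _ new) cp) ds)

    computable-clause : ∀ L {ρ′} → ComputableC CF CP L → ⟦ clF L ⟧ M ρ′ ⇔ ⟦ clF L ⟧ M′ ρ′
    computable-clause L (funs , preds) =
      ⟦clF⟧-coincidence M fI pI L (computable-fun ∘ funs _) (computable-pred ∘ preds _) (λ _ → refl)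

    M′⊨As : All (Sat M′) As
    M′⊨As = All.tabulate λ {A} A∈As ρ′ →
      to (⟦clF⟧-coincidence M fI pI A
            (λ f∈A ds → sym (old-fun _ (λ new → All.lookup (proj₂ (new-fun _ new)) A∈As f∈A) ds))
            (λ p∈A ds → sym (old-pred _ (λ new → All.lookup (proj₂ (new-pred _ new)) A∈As p∈A) ds))
            (λ _ → refl))
         (All.lookup M⊨As A∈As ρ′)

    M′⊨Cjs : All (Sat M′) Cjs
    M′⊨Cjs = All.zipWith (λ {Cj} (Cj-comp , M⊨Cj) ρ′ → to (computable-clause Cj Cj-comp) (M⊨Cj ρ′))
                         (Cjs-comp , M⊨Cjs)

    M′⊨D : Sat M′ D
    M′⊨D = Derived⇒Sat sound M′ (All.++⁺ M′⊨As (All.++⁺ M′⊨S M′⊨Cjs)) D-derived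

    ans-unchanged : ∀ ds → pI ans ds ≡ predI M ans ds
    ans-unchanged = old-pred ans (λ new → proj₂ new ans∈G)

    r-unchanged : evalT M′ ρ r ≡ evalT M ρ r
    r-unchanged = sym (evalT-coincidence M fI pI r (computable-fun ∘ r-comp _) (λ _ → refl))

    true-literal : Any (λ l → ⟦ litF l ⟧ M′ ρ) C ⊎ Any (λ l → ⟦ litF l ⟧ M′ ρ) (pos ans (r ∷ []) ∷ []) →
                   ⟦ atom ans (r ∷ []) ⟧ M ρ
    true-literal (inj₁ C-literal) =
      ⊥-elim (C-false (from (computable-clause C C-comp) (from (⟦clF⟧⇔¬¬Any M′ ρ C) (λ k → k C-literal))))
    true-literal (inj₂ (here ans-r)) =
      subst (λ P → ¬ ¬ P) (trans (ans-unchanged _) (cong (λ d → predI M ans (d ∷ [])) r-unchanged)) ans-r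

    answer : ⟦ atom ans (r ∷ []) ⟧ M ρ
    answer = negated-stable
      (¬¬-map (true-literal ∘ Any.++⁻ C ∘ Any-resp-↭ D↭) (to (⟦clF⟧⇔¬¬Any M′ ρ D) (M′⊨D ρ)))

-- The countermodel

module Countermodel (M : Structure) (ρ : Env M) {k : ℕ} (xs σs : Vec ℕ k) (y : ℕ) (F : Formula) (ans : ℕ) where

  skolemFun : ℕ → List (Dom M) → Dom M
  skolemFun f [] with vindex σs f
  ... | just i  = ρ (lookup xs i)
  ... | nothing = funI M f []
  skolemFun f ds@(_ ∷ _) = funI M f ds

  answerPred : List (Dom M) → Set
  answerPred []      = ⊥
  answerPred (d ∷ _) = ⟦ F ⟧ M (upd ρ y d)

  M′ : Structure
  M′ = expand M skolemFun (upd (predI M) ans answerPred)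

  skolemFun-other : ∀ {f} → (∀ i → lookup σs i ≢ f) → ∀ ds → skolemFun f ds ≡ funI M f ds
  skolemFun-other {f} f∉σs [] with vindex σs f in eq
  ... | just i  = ⊥-elim (f∉σs i (vindex-just σs eq))
  ... | nothing = refl
  skolemFun-other f∉σs (_ ∷ _) = refl

  skolemFun-σ : (∀ i j → lookup σs i ≡ lookup σs j → i ≡ j) →
                ∀ i → skolemFun (lookup σs i) [] ≡ ρ (lookup xs i)
  skolemFun-σ σs-inj i rewrite vindex-lookup σs σs-inj i = refl

  mutual
    evalT-unskT : ∀ t → evalT M′ ρ t ≡ evalT M ρ (unskT xs σs t)
    evalT-unskT (var v) = refl
    evalT-unskT (fun f []) with vindex σs f
    ... | just i  = refl
    ... | nothing = refl
    evalT-unskT (fun f (t ∷ ts)) = cong (funI M f) (evalTs-unskTs (t ∷ ts))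

    evalTs-unskTs : ∀ ts → evalTs M′ ρ ts ≡ evalTs M ρ (unskTs xs σs ts)
    evalTs-unskTs []       = refl
    evalTs-unskTs (t ∷ ts) = cong₂ _∷_ (evalT-unskT t) (evalTs-unskTs ts)

  ⟦unskC⟧ : ∀ L → ¬ PredInC ans L → ⟦ clF L ⟧ M′ ρ ⇔ ⟦ clF (unskC xs σs L) ⟧ M ρ
  ⟦unskC⟧ []      ans∉L = ⇔-id _
  ⟦unskC⟧ (l ∷ L) ans∉L = ¬-cong-⇔ (¬-cong-⇔ (⟦unskL⟧ l (ans∉L ∘ ∨l) ⊎-⇔ ⟦unskC⟧ L (ans∉L ∘ ∨r)))
    where
    predicate : ∀ {p} → p ≢ ans → ∀ ts →
                upd (predI M) ans answerPred p (evalTs M′ ρ ts) ≡ predI M p (evalTs M ρ (unskTs xs σs ts))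
    predicate p≢ans ts =
      trans (cong-app (upd-other (predI M) answerPred p≢ans) _) (cong (predI M _) (evalTs-unskTs ts))

    ⟦unskL⟧ : ∀ l → ¬ PredInF ans (litF l) → ⟦ litF l ⟧ M′ ρ ⇔ ⟦ litF (unskL xs σs l) ⟧ M ρ
    ⟦unskL⟧ (pos p ts) ans∉l = ¬¬-cong-≡ (predicate (λ { refl → ans∉l atm }) ts)
    ⟦unskL⟧ (neg p ts) ans∉l = ¬-cong-⇔ (¬¬-cong-≡ (predicate (λ { refl → ans∉l (neg atm) }) ts))

  ⟦ans⟧⇒⟦F⟧ : ∀ t → ⟦ atom ans (t ∷ []) ⟧ M′ ρ → ⟦ F ⟧ M (upd ρ y (evalT M ρ (unskT xs σs t)))
  ⟦ans⟧⇒⟦F⟧ t ans-t = ⟦⟧-stable F M _ (subst (λ P → ¬ ¬ P) answer ans-t)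
    where
    answer : upd (predI M) ans answerPred ans (evalT M′ ρ t ∷ []) ≡
             ⟦ F ⟧ M (upd ρ y (evalT M ρ (unskT xs σs t)))
    answer = trans (cong-app (upd-same (predI M) ans answerPred) _)
                   (cong (λ d → ⟦ F ⟧ M (upd ρ y d)) (evalT-unskT t))

  -- In M′ both ans(y) and F[σ̄, y] mean F[x̄, y] under ρ, so the goal clause is an instance of
  -- excluded middle, which the ¬¬-semantics validates.
  M′⊨goal : (∀ i → lookup xs i ≢ y) → (∀ v → FreeIn v F → v ≡ y ⊎ Σ (Fin k) (λ i → lookup xs i ≡ v)) →
            (∀ i j → lookup σs i ≡ lookup σs j → i ≡ j) → (∀ i → ¬ FunInF (lookup σs i) F) → ¬ PredInF ans F →
            SatF M′ (goalFormula xs σs y F ans)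
  M′⊨goal xs≢y F-vars σs-inj σs∉F ans∉F ρ″ k =
    k (inj₁ λ F[σ̄,y] → k (inj₂ λ ¬ans[y] → ¬ans[y] (subst id (sym ans[y]≡F[x̄,y]) (to F-equiv F[σ̄,y]))))
    where
    ans[y]≡F[x̄,y] : upd (predI M) ans answerPred ans (ρ″ y ∷ []) ≡ ⟦ F ⟧ M (upd ρ y (ρ″ y))
    ans[y]≡F[x̄,y] = cong-app (upd-same (predI M) ans answerPred) _

    instSk-value : ∀ {v} → FreeIn v F → evalT M′ ρ″ (instSk xs σs v) ≡ upd ρ y (ρ″ y) v
    instSk-value {v} v∈F with vindex xs v in eq
    ... | just i = begin
      skolemFun (lookup σs i) []  ≡⟨ skolemFun-σ σs-inj i ⟩
      ρ (lookup xs i)             ≡⟨ cong ρ (vindex-just xs eq) ⟩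
      ρ v                         ≡⟨ sym (upd-other ρ _ (λ v≡y → xs≢y i (trans (vindex-just xs eq) v≡y))) ⟩
      upd ρ y (ρ″ y) v            ∎
      where open ≡-Reasoning
    ... | nothing with F-vars v v∈F
    ...   | inj₁ refl        = sym (upd-same ρ y (ρ″ y))
    ...   | inj₂ (i , xᵢ≡v) = ⊥-elim (vindex-nothing xs eq i xᵢ≡v)

    agree : Agree M′ (funI M) (predI M) (instSk xs σs) ρ″ (upd ρ y (ρ″ y)) F
    agree = record
      { funs       = λ f∈F → skolemFun-other (λ i σᵢ≡f → σs∉F i (subst (λ g → FunInF g F) (sym σᵢ≡f) f∈F))
      ; preds      = λ p∈F → cong-app (upd-other (predI M) answerPred (λ { refl → ans∉F p∈F }))
      ; values     = instSk-value
      ; no-capture = λ _ → instSk-vars xs σs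
      }

    F-equiv : ⟦ substF (instSk xs σs) F ⟧ M′ ρ″ ⇔ ⟦ F ⟧ M (upd ρ y (ρ″ y))
    F-equiv = ⟦substF⟧ M′ (funI M) (predI M) (instSk xs σs) F agree

  M′⊨As : ∀ {As} → (∀ i → All (λ A → ¬ FunInC (lookup σs i) A) As) → All (λ A → ¬ PredInC ans A) As →
          All (Sat M) As → All (Sat M′) As
  M′⊨As σs∉As ans∉As M⊨As = All.tabulate λ {A} A∈As ρ′ →
    to (⟦clF⟧-coincidence M skolemFun (upd (predI M) ans answerPred) A
          (λ f∈A → sym ∘ skolemFun-other λ i σᵢ≡f →
             All.lookup (σs∉As i) A∈As (subst (λ g → FunInC g A) (sym σᵢ≡f) f∈A))
          (λ p∈A → sym ∘ cong-app (upd-other (predI M) answerPred λ { refl → All.lookup ans∉As A∈As p∈A }))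
          (λ _ → refl))
       (All.lookup M⊨As A∈As ρ′)

  M′⊨Cjs : ∀ {Cjs} → All GroundC Cjs → All (λ Cj → ¬ PredInC ans Cj) Cjs →
           ⟦ bigAnd (map (λ Cj → clF (unskC xs σs Cj)) Cjs) ⟧ M ρ → All (Sat M′) Cjs
  M′⊨Cjs ground ans∉Cjs Cjs-true =
    All.zipWith (λ {Cj} (Cj-ground , ans∉Cj , Cj-true) →
                   ground-sat M′ Cj Cj-ground (from (⟦unskC⟧ Cj ans∉Cj) Cj-true))
                (ground , All.zip (ans∉Cjs , All.map⁻ (⟦bigAnd⟧ _ Cjs-true)))

corollary1 : (CF CP : ℕ → Set) (I : InferenceSystem) (As : List Clause)
    {k : ℕ} (xs : Vec ℕ k) (σs : Vec ℕ k) (y : ℕ) (F : Formula) (ans : ℕ)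
    (r : Term) (C : Clause) (Cjs : List Clause) (S : List Clause) →
    -- x̄ distinct variables, y not among them, F = F[x̄,y]
    (∀ i j → lookup xs i ≡ lookup xs j → i ≡ j) →
    (∀ i → ¬ lookup xs i ≡ y) →
    (∀ v → FreeIn v F → v ≡ y ⊎ Σ (Fin k) (λ i → lookup xs i ≡ v)) →
    -- σ̄ distinct fresh Skolem constants
    (∀ i j → lookup σs i ≡ lookup σs j → i ≡ j) →
    (∀ i → ¬ FunInF (lookup σs i) F) →
    (∀ i → All (λ A → ¬ FunInC (lookup σs i) A) As) →
    (∀ i → ¬ AppliedInF (lookup σs i) (clF (C ++ pos ans (r ∷ []) ∷ []))) →
    (∀ i → All (λ Cj → ¬ AppliedInF (lookup σs i) (clF Cj)) Cjs) →
    -- ans fresh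
    ¬ PredInF ans F →
    All (λ A → ¬ PredInC ans A) As →
    -- r[σ̄] computable; C[σ̄] ground, computable, no answer literal
    ComputableT CF r →
    GroundC C → ComputableC CF CP C → ¬ PredInC ans C →
    -- C_j[σ̄] ground computable, not containing ans
    All (λ Cj → GroundC Cj × ComputableC CF CP Cj × ¬ PredInC ans Cj) Cjs →
    -- S = cnf(¬F[σ̄,y] ∨ ans(y)); its new symbols are uncomputable and fresh
    IsCNF (goalFormula xs σs y F ans) S →
    (∀ f → NewFun (goalFormula xs σs y F ans) S f →
       ¬ CF f × All (λ A → ¬ FunInC f A) As) →
    (∀ p → NewPred (goalFormula xs σs y F ans) S p →
       ¬ CP p × All (λ A → ¬ PredInC p A) As) →
    -- sound inference system, derivation of C[σ̄] ∨ ans(r[σ̄])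
    Sound I →
    Σ Clause (λ D → Derived I (As ++ S ++ Cjs) D × (D ↭ C ++ pos ans (r ∷ []) ∷ [])) →
    ProgramWithConditions CF CP As y F (unskT xs σs r) (conditions xs σs Cjs C)
-- The countermodel reinterprets σ̄ only as constants.
corollary1 CF CP I As xs σs y F ans r C Cjs S _ xs≢y F-vars σs-inj σs∉F σs∉As _ _ ans∉F ans∉As r-comp _ C-comp ans∉C
           Cjs-ok cnf new-fun new-pred sound (D , D-derived , D↭) =
  unskT-computable xs σs r r-comp , conditions-computable xs σs Cjs C Cjs-comp C-comp , correct
  where
  Cjs-comp : All (ComputableC CF CP) Cjs
  Cjs-comp = All.map (proj₁ ∘ proj₂) Cjs-ok

  correct : ∀ M ρ → ⟦ conditions xs σs Cjs C ⟧ M ρ → All (Sat M) As →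
            ⟦ F ⟧ M (upd ρ y (evalT M ρ (unskT xs σs r)))
  correct M ρ (Cjs-true , C-false) M⊨As =
    ⟦ans⟧⇒⟦F⟧ r (answer-sound CF CP sound cnf (∨r atm) new-fun new-pred r-comp C-comp Cjs-comp D-derived D↭
      M′ ρ
      (M′⊨goal xs≢y F-vars σs-inj σs∉F ans∉F)
      (M′⊨As σs∉As ans∉As M⊨As)
      (M′⊨Cjs (All.map proj₁ Cjs-ok) (All.map (proj₂ ∘ proj₂) Cjs-ok) Cjs-true)
      (C-false ∘ to (⟦unskC⟧ C ans∉C)))
    where open Countermodel M ρ xs σs y F ans
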